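{- (1) Let $P \subseteq \{0,1\}^{*}$ be a bar of the binary tree. Then $P$ is a c--set if and only if there exists a function $\delta \colon \{0,1\}^{*} \to \mathbb{N}$ such that for all $a \in \{0,1\}^{*}$, \[ P(a) \leftrightarrow (\forall b \in \{0,1\}^{*})\, \delta(a) = \delta(a*b). \] (2) The continuous bar induction ${\rm c\text{ -- }BI}$ implies the fan theorem ${\rm c\text{ -- }FT}$.
   Context: We work in Bishop-style constructive (intuitionistic) mathematics, without the law of excluded middle, assuming countable choice $(\forall x\in\mathbb{N})(\exists \alpha\in\mathbb{N}^{\mathbb{N}})A(x,\alpha)\to(\exists F)(\forall x)A(x,F(x))$ and unique choice for functions $\mathbb{N}^{\mathbb{N}}\to\mathbb{N}$ (for decidable relations); "$X$ implies $Y$" means $Y$ is provable from $X$ over this base. $\mathbb{N}^{*}$ (resp. $\{0,1\}^{*}$) denotes finite sequences of naturals (resp. bits), $a*b$ concatenation, $\langle\rangle$ the empty sequence, $\langle n\rangle$ a one-element sequence, $\overline{\alpha}n$ the initial segment of length $n$ of an infinite sequence $\alpha$. A predicate $P\subseteq \{0,1\}^*$ is a bar of the binary tree if $(\forall \alpha\in\{0,1\}^{\mathbb{N}})(\exists n)P(\overline{\alpha}n)$; it is uniform if $(\exists N)(\forall\alpha\in\{0,1\}^{\mathbb{N}})(\exists n\le N)P(\overline{\alpha}n)$. A predicate $D$ is detachable if $(\forall t)(D(t)\vee\neg D(t))$. $C\subseteq\{0,1\}^*$ is a c--set if there is a detachable $D\subseteq\{0,1\}^*$ with $C(a)\leftrightarrow(\forall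 b\in\{0,1\}^*)D(a*b)$ for all $a$. ${\rm c\text{ -- }FT}$: every bar of the binary tree that is a c--set is uniform. A predicate $P\subseteq\mathbb{N}^*$ is a bar if $(\forall\alpha\in\mathbb{N}^{\mathbb{N}})(\exists n)P(\overline{\alpha}n)$; a bar $P$ is a c--bar if there is $\delta\colon\mathbb{N}^*\to\mathbb{N}$ with $P(a)\leftrightarrow(\forall b\in\mathbb{N}^*)\delta(a)=\delta(a*b)$ for all $a\in\mathbb{N}^*$. $Q\subseteq\mathbb{N}^*$ is inductive if $(\forall a)[(\forall n)Q(a*\langle n\rangle)\to Q(a)]$. ${\rm c\text{ -- }BI}$: for every c--bar $P\subseteq\mathbb{N}^*$ and every predicate $Q\subseteq\mathbb{N}^*$, if $P\subseteq Q$ and $Q$ is inductive then $Q(\langle\rangle)$. -}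

module Defs where

open import Level using (Level; _⊔_) renaming (suc to lsuc)
open import Data.Nat using (ℕ; _≤_)
open import Data.Bool using (Bool)
open import Data.List using (List; []; _∷_; _++_; [_])
open import Data.Product using (Σ; ∃; ∃-syntax; _×_)
open import Relation.Nullary using (¬_; Dec)
open import Relation.Binary.PropositionalEquality using (_≡_)

-- Finite sequences are lists; a * b is  a ++ b ; ⟨⟩ is [] ; ⟨ n ⟩ is [ n ].

_⟷_ : ∀ {a b} → Set a → Set b → Set (a ⊔ b)
A ⟷ B = (A → B) × (B → A)

initSeg : ∀ {A : Set} → (ℕ → A) → ℕ → List A
initSeg α 0 = []
initSeg α (ℕ.suc n) = α 0 ∷ initSeg (λ k → α (ℕ.suc k)) n

module _ {ℓ : Level} where

  IsBinBar : (List Bool → Set ℓ) → Set ℓ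
  IsBinBar P = (α : ℕ → Bool) → ∃[ n ] P (initSeg α n)

  IsUniform : (List Bool → Set ℓ) → Set ℓ
  IsUniform P = ∃[ N ] ((α : ℕ → Bool) → ∃[ n ] (n ≤ N × P (initSeg α n)))

  Detachable : ∀ {A : Set} → (A → Set ℓ) → Set ℓ
  Detachable D = ∀ t → Dec (D t)

  IsCSet : (List Bool → Set ℓ) → Set (lsuc ℓ)
  IsCSet C = Σ (List Bool → Set ℓ) λ D →
               Detachable D × (∀ a → C a ⟷ (∀ (b : List Bool) → D (a ++ b)))

  IsBar : (List ℕ → Set ℓ) → Set ℓ
  IsBar P = (α : ℕ → ℕ) → ∃[ n ] P (initSeg α n)

  IsCBar : (List ℕ → Set ℓ) → Set ℓ
  IsCBar P = IsBar P × Σ (List ℕ → ℕ) λ δ →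
               (∀ a → P a ⟷ (∀ (b : List ℕ) → δ a ≡ δ (a ++ b)))

  Inductive : (List ℕ → Set ℓ) → Set ℓ
  Inductive Q = ∀ a → (∀ n → Q (a ++ [ n ])) → Q a

CFT : (ℓ : Level) → Set (lsuc ℓ)
CFT ℓ = (P : List Bool → Set ℓ) → IsBinBar P → IsCSet P → IsUniform P

CBI : (ℓ : Level) → Set (lsuc ℓ)
CBI ℓ = (P Q : List ℕ → Set ℓ) → IsCBar P →
        (∀ a → P a → Q a) → Inductive Q → Q []

-- (1, ⇒) For a detachable D, let f(c) be 0 if D(c) and 1 otherwise, and let
--   δ(a) be the sum of f over the proper prefixes of a.  Then δ is constant
--   above a iff f vanishes on every extension of a, i.e. iff D holds there.
-- (1, ⇐) Given δ, take D(c) := "δ does not change from c to its two immediate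
--   successors", which is decidable; δ is constant above a iff D holds on every
--   extension of a.
-- (2) Transport a binary c-bar P to the Baire tree along the letterwise map
--   ℕ → Bool (0 ↦ false, else true); it stays a bar and keeps the pulled-back
--   modulus, so it is a c-bar.  Then apply c-BI to Q(a) := "P is uniform above
--   the image of a", which contains the bar and is inductive because uniformity
--   above both children of a node gives uniformity above the node.
module Submission where

open import Defs
open import Level using (Level; Lift; lift; lower)
open import Function using (_∘_)
open import Data.Nat using (ℕ; zero; suc; _+_; _≤_; z≤n; s≤s; _⊔_; _≟_)
open import Data.Nat.Properties
  using (+-identityʳ; +-assoc; +-cancelˡ-≡; m+n≡0⇒n≡0; ≤-trans; m≤m⊔n; m≤n⊔m)
open import Data.Bool using (Bool; true; false)
open import Data.List using (List; []; _∷_; _++_; [_]; map)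
open import Data.List.Properties using (++-assoc; ++-identityʳ; map-++; map-∘; map-cong; map-id)
open import Data.Product using (Σ; ∃-syntax; _×_; _,_; proj₁; proj₂)
open import Data.Empty using (⊥-elim)
open import Relation.Nullary using (Dec; yes; no)
open import Relation.Nullary.Decidable using (map′; _×-dec_)
open import Relation.Binary.PropositionalEquality using (_≡_; refl; sym; trans; cong; cong₂; subst)
open Relation.Binary.PropositionalEquality.≡-Reasoning

⟷-sym : ∀ {a b} {A : Set a} {B : Set b} → A ⟷ B → B ⟷ A
⟷-sym (f , g) = g , f

⟷-trans : ∀ {a b c} {A : Set a} {B : Set b} {C : Set c} → A ⟷ B → B ⟷ C → A ⟷ C
⟷-trans (f , g) (h , k) = h ∘ f , g ∘ k

∀-⟷ : ∀ {a b c} {I : Set a} {A : I → Set b} {B : I → Set c} →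
      (∀ i → A i ⟷ B i) → (∀ i → A i) ⟷ (∀ i → B i)
∀-⟷ eq = (λ h i → proj₁ (eq i) (h i)) , (λ h i → proj₂ (eq i) (h i))

ConstantAbove : {A : Set} → (List A → ℕ) → List A → Set
ConstantAbove δ a = ∀ b → δ a ≡ δ (a ++ b)

Modulus : ∀ {ℓ} {A : Set} → (List A → Set ℓ) → (List A → ℕ) → Set ℓ
Modulus P δ = ∀ a → P a ⟷ ConstantAbove δ a

prefixSum : {A : Set} → (List A → ℕ) → List A → ℕ
prefixSum f []      = 0
prefixSum f (x ∷ a) = f [] + prefixSum (f ∘ (x ∷_)) a

prefixSum-++ : {A : Set} (f : List A → ℕ) (a b : List A) →
               prefixSum f (a ++ b) ≡ prefixSum f a + prefixSum (f ∘ (a ++_)) b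
prefixSum-++ f []      b = refl
prefixSum-++ f (x ∷ a) b = begin
  f [] + prefixSum (f ∘ (x ∷_)) (a ++ b)
    ≡⟨ cong (f [] +_) (prefixSum-++ (f ∘ (x ∷_)) a b) ⟩
  f [] + (prefixSum (f ∘ (x ∷_)) a + prefixSum (f ∘ ((x ∷ a) ++_)) b)
    ≡⟨ sym (+-assoc (f []) _ _) ⟩
  f [] + prefixSum (f ∘ (x ∷_)) a + prefixSum (f ∘ ((x ∷ a) ++_)) b ∎

prefixSum-snoc : {A : Set} (f : List A → ℕ) (b : List A) (x : A) →
                 prefixSum f (b ++ [ x ]) ≡ prefixSum f b + f b
prefixSum-snoc f []      x = +-identityʳ (f [])
prefixSum-snoc f (y ∷ b) x = trans (cong (f [] +_) (prefixSum-snoc (f ∘ (y ∷_)) b x))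
                                   (sym (+-assoc (f []) _ _))

prefixSum-vanishes : {A : Set} (f : List A → ℕ) → (∀ c → f c ≡ 0) → ∀ b → prefixSum f b ≡ 0
prefixSum-vanishes f f≡0 []      = refl
prefixSum-vanishes f f≡0 (y ∷ b) =
  cong₂ _+_ (f≡0 []) (prefixSum-vanishes (f ∘ (y ∷_)) (f≡0 ∘ (y ∷_)) b)

-- Over an inhabited alphabet, prefixSum f is constant above a exactly when
-- f vanishes on every extension of a (the extra letter x exposes f at a ++ b).
prefixSum-constant⟷vanishing : {A : Set} (x : A) (f : List A → ℕ) (a : List A) →
  ConstantAbove (prefixSum f) a ⟷ (∀ b → f (a ++ b) ≡ 0)
prefixSum-constant⟷vanishing x f a = vanishing , constant
  where
  g = f ∘ (a ++_)
  increase : ∀ b → prefixSum f (a ++ b) ≡ prefixSum f a + prefixSum g b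
  increase = prefixSum-++ f a

  vanishing : ConstantAbove (prefixSum f) a → ∀ b → g b ≡ 0
  vanishing const b = m+n≡0⇒n≡0 (prefixSum g b) (+-cancelˡ-≡ (prefixSum f a) _ _ (begin
    prefixSum f a + (prefixSum g b + g b) ≡⟨ cong (prefixSum f a +_) (sym (prefixSum-snoc g b x)) ⟩
    prefixSum f a + prefixSum g (b ++ [ x ]) ≡⟨ sym (increase (b ++ [ x ])) ⟩
    prefixSum f (a ++ (b ++ [ x ]))          ≡⟨ sym (const (b ++ [ x ])) ⟩
    prefixSum f a                            ≡⟨ sym (+-identityʳ _) ⟩
    prefixSum f a + 0                        ∎))

  constant : (∀ b → g b ≡ 0) → ConstantAbove (prefixSum f) a
  constant g≡0 b = sym (begin
    prefixSum f (a ++ b)          ≡⟨ increase b ⟩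
    prefixSum f a + prefixSum g b ≡⟨ cong (prefixSum f a +_) (prefixSum-vanishes g g≡0 b) ⟩
    prefixSum f a + 0             ≡⟨ +-identityʳ _ ⟩
    prefixSum f a                 ∎)

defect : ∀ {ℓ} {X : Set ℓ} → Dec X → ℕ
defect (yes _) = 0
defect (no _)  = 1

defect≡0⟷ : ∀ {ℓ} {X : Set ℓ} (d : Dec X) → (defect d ≡ 0) ⟷ X
defect≡0⟷ (yes x) = (λ _ → x) , (λ _ → refl)
defect≡0⟷ (no ¬x) = (λ ()) , (λ x → ⊥-elim (¬x x))

cSet⇒modulus : ∀ {ℓ} (P : List Bool → Set ℓ) → IsCSet P → Σ (List Bool → ℕ) (Modulus P)
cSet⇒modulus P (D , D? , P⟷D) = prefixSum f , λ a →
  ⟷-trans (P⟷D a)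
    (⟷-trans (⟷-sym (∀-⟷ (λ b → defect≡0⟷ (D? (a ++ b)))))
             (⟷-sym (prefixSum-constant⟷vanishing false f a)))
  where
  f : List Bool → ℕ
  f c = defect (D? c)

StepConstant : {A : Set} → (List A → ℕ) → List A → Set
StepConstant δ c = ∀ x → δ (c ++ [ x ]) ≡ δ c

stepConstant? : (δ : List Bool → ℕ) (c : List Bool) → Dec (StepConstant δ c)
stepConstant? δ c = map′ (λ { (p , q) false → p ; (p , q) true → q })
                         (λ h → h false , h true)
                         ((δ (c ++ [ false ]) ≟ δ c) ×-dec (δ (c ++ [ true ]) ≟ δ c))

stepConstant⇒constant : {A : Set} (g : List A → ℕ) →
                        (∀ b x → g (b ++ [ x ]) ≡ g b) → ∀ b → g b ≡ g []
stepConstant⇒constant g step []      = refl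
stepConstant⇒constant g step (x ∷ b) =
  trans (stepConstant⇒constant (g ∘ (x ∷_)) (step ∘ (x ∷_)) b) (step [] x)

constant⟷stepConstant : {A : Set} (δ : List A → ℕ) (a : List A) →
  ConstantAbove δ a ⟷ (∀ b → StepConstant δ (a ++ b))
constant⟷stepConstant δ a = stepwise , constant
  where
  stepwise : ConstantAbove δ a → ∀ b → StepConstant δ (a ++ b)
  stepwise const b x = begin
    δ ((a ++ b) ++ [ x ]) ≡⟨ cong δ (++-assoc a b [ x ]) ⟩
    δ (a ++ (b ++ [ x ])) ≡⟨ sym (const (b ++ [ x ])) ⟩
    δ a                   ≡⟨ const b ⟩
    δ (a ++ b)            ∎

  constant : (∀ b → StepConstant δ (a ++ b)) → ConstantAbove δ a
  constant step b = begin
    δ a        ≡⟨ cong δ (sym (++-identityʳ a)) ⟩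
    δ (a ++ []) ≡⟨ sym (stepConstant⇒constant (δ ∘ (a ++_)) shiftedStep b) ⟩
    δ (a ++ b)  ∎
    where
    shiftedStep : ∀ b x → δ (a ++ (b ++ [ x ])) ≡ δ (a ++ b)
    shiftedStep b x = trans (cong δ (sym (++-assoc a b [ x ]))) (step b x)

modulus⇒cSet : ∀ {ℓ} (P : List Bool → Set ℓ) → Σ (List Bool → ℕ) (Modulus P) → IsCSet P
modulus⇒cSet {ℓ} P (δ , P⟷const) = D , D? , λ a →
  ⟷-trans (P⟷const a)
    (⟷-trans (constant⟷stepConstant δ a) (∀-⟷ (λ _ → lift , lower)))
  where
  D : List Bool → Set ℓ
  D c = Lift ℓ (StepConstant δ c)
  D? : Detachable D
  D? c = map′ lift lower (stepConstant? δ c)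

uniform-mono : ∀ {ℓ} {R S : List Bool → Set ℓ} → (∀ s → R s → S s) → IsUniform R → IsUniform S
uniform-mono R⊆S (N , u) = N , λ α → let (n , n≤N , r) = u α in n , n≤N , R⊆S _ r

uniform-root : ∀ {ℓ} {R : List Bool → Set ℓ} → R [] → IsUniform R
uniform-root r = 0 , λ _ → 0 , z≤n , r

uniform-children : ∀ {ℓ} {R : List Bool → Set ℓ} →
  IsUniform (R ∘ (false ∷_)) → IsUniform (R ∘ (true ∷_)) → IsUniform R
uniform-children {R = R} (N₀ , u₀) (N₁ , u₁) = suc (N₀ ⊔ N₁) , λ α →
  let (n , n≤ , r) = below (α 0) (λ k → α (suc k)) in suc n , s≤s n≤ , r
  where
  below : (x : Bool) (β : ℕ → Bool) → ∃[ n ] (n ≤ N₀ ⊔ N₁ × R (x ∷ initSeg β n))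
  below false β = let (n , n≤N₀ , r) = u₀ β in n , ≤-trans n≤N₀ (m≤m⊔n N₀ N₁) , r
  below true  β = let (n , n≤N₁ , r) = u₁ β in n , ≤-trans n≤N₁ (m≤n⊔m N₀ N₁) , r

initSeg-map : {A B : Set} (g : A → B) (α : ℕ → A) (n : ℕ) →
              initSeg (g ∘ α) n ≡ map g (initSeg α n)
initSeg-map g α zero    = refl
initSeg-map g α (suc n) = cong (g (α 0) ∷_) (initSeg-map g (α ∘ suc) n)

modulus-map : ∀ {ℓ} {A B : Set} (g : B → A) (s : A → B) → (∀ x → g (s x) ≡ x) →
  {P : List A → Set ℓ} {δ : List A → ℕ} → Modulus P δ → Modulus (P ∘ map g) (δ ∘ map g)
modulus-map g s gs≡id {P} {δ} P⟷const a = ⟷-trans (P⟷const (map g a)) (pull , push)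
  where
  g∘s≗id : ∀ b → map g (map s b) ≡ b
  g∘s≗id b = trans (sym (map-∘ b)) (trans (map-cong gs≡id b) (map-id b))

  pull : ConstantAbove δ (map g a) → ConstantAbove (δ ∘ map g) a
  pull const b = trans (const (map g b)) (cong δ (sym (map-++ g a b)))

  push : ConstantAbove (δ ∘ map g) a → ConstantAbove δ (map g a)
  push const b = begin
    δ (map g a)                   ≡⟨ const (map s b) ⟩
    δ (map g (a ++ map s b))      ≡⟨ cong δ (map-++ g a (map s b)) ⟩
    δ (map g a ++ map g (map s b)) ≡⟨ cong (λ c → δ (map g a ++ c)) (g∘s≗id b) ⟩
    δ (map g a ++ b)              ∎

toBool : ℕ → Bool
toBool zero    = false
toBool (suc _) = true

fromBool : Bool → ℕ
fromBool false = 0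
fromBool true  = 1

toBool-fromBool : ∀ x → toBool (fromBool x) ≡ x
toBool-fromBool false = refl
toBool-fromBool true  = refl

cSetBar⇒cBar : ∀ {ℓ} (P : List Bool → Set ℓ) → IsBinBar P → IsCSet P → IsCBar (P ∘ map toBool)
cSetBar⇒cBar P bar cset = bar′ , δ ∘ map toBool , modulus-map toBool fromBool toBool-fromBool P⟷const
  where
  δ = proj₁ (cSet⇒modulus P cset)
  P⟷const = proj₂ (cSet⇒modulus P cset)
  bar′ : IsBar (P ∘ map toBool)
  bar′ α = let (n , p) = bar (toBool ∘ α) in n , subst P (initSeg-map toBool α n) p

cBI⇒cFT : ∀ {ℓ} → CBI ℓ → CFT ℓ
cBI⇒cFT cbi P bar cset =
  cbi (P ∘ map toBool) UniformAbove (cSetBar⇒cBar P bar cset) barNode uniformAbove-inductive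
  where
  Above : List ℕ → List Bool → Set _
  Above a s = P (map toBool a ++ s)

  UniformAbove : List ℕ → Set _
  UniformAbove a = IsUniform (Above a)

  barNode : ∀ a → P (map toBool a) → UniformAbove a
  barNode a p = uniform-root {R = Above a} (subst P (sym (++-identityʳ _)) p)

  child : ∀ a n → UniformAbove (a ++ [ n ]) → IsUniform (Above a ∘ (toBool n ∷_))
  child a n = uniform-mono λ s → subst P (begin
    map toBool (a ++ [ n ]) ++ s        ≡⟨ cong (_++ s) (map-++ toBool a [ n ]) ⟩
    (map toBool a ++ [ toBool n ]) ++ s ≡⟨ ++-assoc (map toBool a) [ toBool n ] s ⟩
    map toBool a ++ (toBool n ∷ s)      ∎)

  uniformAbove-inductive : Inductive UniformAbove
  uniformAbove-inductive a h = uniform-children {R = Above a} (child a 0 (h 0)) (child a 1 (h 1))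

proposition2p1 : {ℓ : Level} →
    ((P : List Bool → Set ℓ) → IsBinBar P →
       IsCSet P ⟷ Σ (List Bool → ℕ) (λ δ → ∀ a → P a ⟷ (∀ (b : List Bool) → δ a ≡ δ (a ++ b))))
    × (CBI ℓ → CFT ℓ)
proposition2p1 = (λ P _ → cSet⇒modulus P , modulus⇒cSet P) , cBI⇒cFT
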